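{- A permutation $\sigma\in\mathfrak S_n$ belongs to $\mathfrak{SS}_n$ if and only if the following hold: the rightmost node of $T(\sigma)$ is labeled $n$; no node of $T(\sigma)$ has a lone left child (i.e. exactly one child, which is a left child); and for every node $s$ not on the rightmost path of $T(\sigma)$ that has both a left child $t$ and a right child $u$, we have $t>u$.
   Context: A permutation is simsun if for every $k\geq0$, removing its $k$ largest entries yields a permutation with no consecutive descents (no $i$ with $\pi_i>\pi_{i+1}>\pi_{i+2}$). $\mathfrak{SS}_n$ is the set of simsun permutations in $\mathfrak S_n$ whose last entry is $n$. For a word $w$ with distinct letters, the min-tree $T(w)$ is the increasing planar binary tree defined recursively: the empty word gives the empty tree; otherwise, with $m$ the smallest letter and $w=w_1\,m\,w_2$, the root is labeled $m$ with left subtree $T(w_1)$ and right subtree $T(w_2)$. Reading the labels in in-order (left subtree, root, right subtree) recovers $w$; the rightmost node is the last node in this reading (the node labeled by the last letter of $w$), and the rightmost path is the path from the root to the rightmost node. -}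

module Defs where

open import Data.Nat using (ℕ; zero; suc; _∸_; _<_; _>_; _≤?_)
open import Data.Nat.Properties using (_≟_)
open import Data.List using (List; []; _∷_; length; filter; last; applyUpTo)
open import Data.List.Relation.Binary.Permutation.Propositional using (_↭_)
open import Data.Maybe using (Maybe; just; nothing)
open import Data.Product using (_×_; _,_; ∃)
open import Data.Unit using (⊤)
open import Data.Empty using (⊥)
open import Relation.Nullary using (¬_; yes; no)
open import Relation.Binary.PropositionalEquality using (_≡_)

-- σ ∈ 𝔖_n : σ (one-line notation) is a rearrangement of [1, 2, …, n]
IsPerm : ℕ → List ℕ → Set
IsPerm n σ = σ ↭ applyUpTo suc n

NoDoubleDescent : List ℕ → Set
NoDoubleDescent (a ∷ b ∷ c ∷ rest) = ¬ (a > b × b > c) × NoDoubleDescent (b ∷ c ∷ rest)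
NoDoubleDescent _ = ⊤

-- removing the k largest entries of a permutation of [1..n] = keeping entries ≤ n ∸ k
removeLargest : ℕ → ℕ → List ℕ → List ℕ
removeLargest n k σ = filter (λ x → x ≤? n ∸ k) σ

Simsun : ℕ → List ℕ → Set
Simsun n σ = (k : ℕ) → NoDoubleDescent (removeLargest n k σ)

InSS : ℕ → List ℕ → Set
InSS n σ = Simsun n σ × last σ ≡ just n

data Tree : Set where
  leaf : Tree
  node : Tree → ℕ → Tree → Tree

minOf : ℕ → List ℕ → ℕ
minOf a [] = a
minOf a (x ∷ xs) with x Data.Nat.<? a
... | yes _ = minOf x xs
... | no _ = minOf a xs

splitAt' : ℕ → List ℕ → List ℕ × List ℕ
splitAt' m [] = [] , []
splitAt' m (x ∷ xs) with x ≟ m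
... | yes _ = [] , xs
... | no _ with splitAt' m xs
...   | (l , r) = (x ∷ l) , r

-- min-tree with fuel (fuel = length w suffices: each recursive call is on a strictly shorter word)
minTreeF : ℕ → List ℕ → Tree
minTreeF zero _ = leaf
minTreeF (suc f) [] = leaf
minTreeF (suc f) (a ∷ xs) with minOf a xs
... | m with splitAt' m (a ∷ xs)
...   | (w₁ , w₂) = node (minTreeF f w₁) m (minTreeF f w₂)

T : List ℕ → Tree
T w = minTreeF (length w) w

rightmostLabel : Tree → Maybe ℕ
rightmostLabel leaf = nothing
rightmostLabel (node l a leaf) = just a
rightmostLabel (node l a (node rl b rr)) = rightmostLabel (node rl b rr)

NoLoneLeft : Tree → Set
NoLoneLeft leaf = ⊤
NoLoneLeft (node (node ll b lr) a leaf) = ⊥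
NoLoneLeft (node l a r) = NoLoneLeft l × NoLoneLeft r

AllNodesLeftGtRight : Tree → Set
AllNodesLeftGtRight leaf = ⊤
AllNodesLeftGtRight (node (node ll b lr) a (node rl c rr)) =
  b > c × AllNodesLeftGtRight (node ll b lr) × AllNodesLeftGtRight (node rl c rr)
AllNodesLeftGtRight (node l a r) = AllNodesLeftGtRight l × AllNodesLeftGtRight r

-- every node NOT on the rightmost path (root → rightmost node) satisfies the condition:
-- nodes on the path are the root and, recursively, those on the path of the right subtree;
-- the left subtree of a path node lies entirely off the path
OffRightPathCond : Tree → Set
OffRightPathCond leaf = ⊤
OffRightPathCond (node l a r) = AllNodesLeftGtRight l × OffRightPathCond r

module Submission where

-- Restricting a word w to its letters ≤ j (written w ↾ j) is the same as
-- removing its largest entries, so for σ ∈ 𝔖ₙ being simsun means that every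
-- restriction σ ↾ j has no double descent.  Write a word with distinct letters
-- as w = u m v with m its minimum; then for every threshold j either m is cut
-- away (and the whole restriction is empty) or (u m v) ↾ j = (u ↾ j) m (v ↾ j).
-- From this, two word lemmas follow:
--   * every restriction of u m v avoids double descents iff the same holds for
--     u and v, and no restriction of u ends in a descent;
--   * no restriction of u m v ends in a descent iff the same holds for v, and
--     every threshold emptying v also empties u — which, in terms of the
--     min-trees of u and v, says that the root of T(u) exceeds that of T(v).
-- By induction along the min-tree this turns "simsun" into a purely
-- tree-shaped predicate, which a short tree induction identifies with the
-- three conditions of the proposition once the rightmost node has no left
-- child; that in turn holds because the rightmost label is the last letter of
-- σ, which is n, the largest letter.

open import Defs
open import Data.Nat using (ℕ; zero; suc; _+_; _≤_; _<_; _>_; _≤?_; _<?_; _∸_; s≤s⁻¹)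
open import Data.Nat.Properties
open import Data.List using (List; []; _∷_; _++_; length; filter; last)
open import Data.List.Properties using (length-++; filter-++; filter-accept; filter-none; filter-all)
open import Data.List.Relation.Unary.All as All using (All; []; _∷_)
open import Data.List.Relation.Unary.All.Properties using (++⁺; ++⁻ˡ; ++⁻ʳ; filter⁺)
open import Data.List.Relation.Unary.Any using (here; there)
open import Data.List.Relation.Unary.Unique.Propositional using (Unique; []; _∷_)
open import Data.List.Relation.Unary.Unique.Propositional.Properties using (applyUpTo⁺₁)
open import Data.List.Relation.Binary.Disjoint.Propositional using (Disjoint)
open import Data.List.Membership.Propositional using (_∈_; _∉_)
open import Data.List.Membership.Propositional.Properties using (∈-++⁺ʳ; ∈-applyUpTo⁻; ∈-filter⁺)
open import Data.List.Relation.Binary.Permutation.Propositional using (↭-sym; ↭⇒↭ₛ)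
open import Data.List.Relation.Binary.Permutation.Propositional.Properties using (∈-resp-↭)
open import Data.Maybe using (just)
open import Data.Maybe.Properties using (just-injective)
open import Data.Product using (_×_; _,_; proj₁; proj₂; ∃)
open import Data.Product.Function.NonDependent.Propositional using (_×-⇔_)
open import Data.Unit using (⊤; tt)
open import Data.Empty using (⊥; ⊥-elim)
open import Function using (_∘_; id)
open import Function.Bundles using (_⇔_; mk⇔; Equivalence)
open import Function.Properties.Equivalence using () renaming (trans to ⇔-trans)
open import Relation.Nullary using (¬_; yes; no)
open import Relation.Binary.PropositionalEquality
  using (_≡_; _≢_; refl; cong; sym; trans; subst; setoid; module ≡-Reasoning)
open import Data.List.Relation.Binary.Permutation.Setoid.Properties (setoid ℕ) using (Unique-resp-↭)

open Equivalence using (to; from)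

_↾_ : List ℕ → ℕ → List ℕ
w ↾ j = filter (_≤? j) w

↾-split : ∀ {m j} u v → m ≤ j → (u ++ m ∷ v) ↾ j ≡ u ↾ j ++ m ∷ v ↾ j
↾-split {m} {j} u v m≤j = begin
  (u ++ m ∷ v) ↾ j      ≡⟨ filter-++ (_≤? j) u (m ∷ v) ⟩
  u ↾ j ++ (m ∷ v) ↾ j  ≡⟨ cong (u ↾ j ++_) (filter-accept (_≤? j) m≤j) ⟩
  u ↾ j ++ m ∷ v ↾ j    ∎
  where open ≡-Reasoning

↾-empty : ∀ {j} w → All (j <_) w → w ↾ j ≡ []
↾-empty {j} w j<w = filter-none (_≤? j) (All.map <⇒≱ j<w)

↾-below-min : ∀ {j m} w → j < m → All (m ≤_) w → w ↾ j ≡ []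
↾-below-min w j<m m≤w = ↾-empty w (All.map (<-≤-trans j<m) m≤w)

↾-nonempty : ∀ {x j w} → x ∈ w → x ≤ j → w ↾ j ≢ []
↾-nonempty {j = j} x∈w x≤j w↾j≡[] with subst (_ ∈_) w↾j≡[] (∈-filter⁺ (_≤? j) x∈w x≤j)
... | ()

EndsInDescent : List ℕ → Set
EndsInDescent (x ∷ y ∷ []) = x > y
EndsInDescent (x ∷ y ∷ z ∷ r) = EndsInDescent (y ∷ z ∷ r)
EndsInDescent _ = ⊥

endsInDescent-++ : ∀ {y z r} u → EndsInDescent (u ++ y ∷ z ∷ r) ≡ EndsInDescent (y ∷ z ∷ r)
endsInDescent-++ [] = refl
endsInDescent-++ (a ∷ []) = refl
endsInDescent-++ (a ∷ b ∷ []) = refl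
endsInDescent-++ (a ∷ b ∷ c ∷ u) = endsInDescent-++ (b ∷ c ∷ u)

endsInDescent-snoc-min : ∀ {m} a u → All (m <_) (a ∷ u) → EndsInDescent ((a ∷ u) ++ m ∷ [])
endsInDescent-snoc-min a [] (m<a ∷ _) = m<a
endsInDescent-snoc-min a (b ∷ []) (_ ∷ m<b) = endsInDescent-snoc-min b [] m<b
endsInDescent-snoc-min a (b ∷ c ∷ u) (_ ∷ m<bcu) = endsInDescent-snoc-min b (c ∷ u) m<bcu

min-lowerBound : ∀ {m} u v → All (m <_) u → All (m <_) v → All (m ≤_) (u ++ m ∷ v)
min-lowerBound u v m<u m<v = ++⁺ (All.map <⇒≤ m<u) (≤-refl ∷ All.map <⇒≤ m<v)

noDoubleDescent-min∷ : ∀ {m} v → All (m <_) v → NoDoubleDescent (m ∷ v) ⇔ NoDoubleDescent v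
noDoubleDescent-min∷ [] _ = mk⇔ (λ _ → tt) (λ _ → tt)
noDoubleDescent-min∷ (x ∷ []) _ = mk⇔ (λ _ → tt) (λ _ → tt)
noDoubleDescent-min∷ (x ∷ y ∷ r) (m<x ∷ _) = mk⇔ proj₂ (λ h → (λ (m>x , _) → <-asym m<x m>x) , h)

-- u m v avoids double descents iff u and v do and u does not end in a descent
-- (a final descent a > b of u would continue into b > m).
noDoubleDescent-split : ∀ {m} u v → All (m <_) u → All (m <_) v →
  NoDoubleDescent (u ++ m ∷ v) ⇔ (NoDoubleDescent u × NoDoubleDescent v × ¬ EndsInDescent u)
noDoubleDescent-split u v m<u m<v = mk⇔ (split u v m<u m<v) (join u v m<u m<v)
  where
  split : ∀ {m} u v → All (m <_) u → All (m <_) v → NoDoubleDescent (u ++ m ∷ v) →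
          NoDoubleDescent u × NoDoubleDescent v × ¬ EndsInDescent u
  split [] v _ m<v h = tt , to (noDoubleDescent-min∷ v m<v) h , λ ()
  split (a ∷ []) [] _ _ _ = tt , tt , λ ()
  split (a ∷ []) (x ∷ r) _ m<v h = tt , to (noDoubleDescent-min∷ (x ∷ r) m<v) (proj₂ h) , λ ()
  split (a ∷ b ∷ []) v (_ ∷ m<b ∷ []) m<v (no-abm , h) =
    tt , proj₁ (proj₂ (split (b ∷ []) v (m<b ∷ []) m<v h)) , λ a>b → no-abm (a>b , m<b)
  split (a ∷ b ∷ c ∷ u) v (_ ∷ m<bcu) m<v (no-abc , h) =
    let (ndd-u , ndd-v , ned-u) = split (b ∷ c ∷ u) v m<bcu m<v h
    in (no-abc , ndd-u) , ndd-v , ned-u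

  join : ∀ {m} u v → All (m <_) u → All (m <_) v →
         NoDoubleDescent u × NoDoubleDescent v × ¬ EndsInDescent u → NoDoubleDescent (u ++ m ∷ v)
  join [] v _ m<v (_ , ndd-v , _) = from (noDoubleDescent-min∷ v m<v) ndd-v
  join (a ∷ []) [] _ _ _ = tt
  join (a ∷ []) (x ∷ r) _ m<v@(m<x ∷ _) (_ , ndd-v , _) =
    (λ (_ , m>x) → <-asym m<x m>x) , from (noDoubleDescent-min∷ (x ∷ r) m<v) ndd-v
  join (a ∷ b ∷ []) v (_ ∷ m<b ∷ []) m<v (_ , ndd-v , ned-u) =
    (λ (a>b , _) → ned-u a>b) , join (b ∷ []) v (m<b ∷ []) m<v (tt , ndd-v , λ ())
  join (a ∷ b ∷ c ∷ u) v (_ ∷ m<bcu) m<v ((no-abc , ndd-u) , ndd-v , ned-u) =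
    no-abc , join (b ∷ c ∷ u) v m<bcu m<v (ndd-u , ndd-v , ned-u)

noEndDescent-split : ∀ {m} u v → All (m <_) u → All (m <_) v →
  (¬ EndsInDescent (u ++ m ∷ v)) ⇔ (¬ EndsInDescent v × (v ≡ [] → u ≡ []))
noEndDescent-split u v m<u m<v = mk⇔ (split u v m<u) (join u v m<v)
  where
  split : ∀ {m} u v → All (m <_) u → ¬ EndsInDescent (u ++ m ∷ v) →
          ¬ EndsInDescent v × (v ≡ [] → u ≡ [])
  split [] [] _ _ = (λ ()) , λ _ → refl
  split (a ∷ u) [] m<au h = (λ ()) , λ _ → ⊥-elim (h (endsInDescent-snoc-min a u m<au))
  split u (x ∷ []) _ _ = (λ ()) , λ ()
  split u (x ∷ y ∷ r) _ h = (λ d → h (subst id (sym (endsInDescent-++ u)) d)) , λ ()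

  join : ∀ {m} u v → All (m <_) v → ¬ EndsInDescent v × (v ≡ [] → u ≡ []) →
         ¬ EndsInDescent (u ++ m ∷ v)
  join u [] _ (_ , u≡[]) with u≡[] refl
  ... | refl = λ ()
  join u (x ∷ []) (m<x ∷ _) _ d = <-asym m<x (subst id (endsInDescent-++ u) d)
  join u (x ∷ y ∷ r) _ (ned-v , _) d = ned-v (subst id (endsInDescent-++ u) d)

Simsun↾ : List ℕ → Set
Simsun↾ w = ∀ j → NoDoubleDescent (w ↾ j)

NoEndDescent↾ : List ℕ → Set
NoEndDescent↾ w = ∀ j → ¬ EndsInDescent (w ↾ j)

EmptiesFirst : List ℕ → List ℕ → Set
EmptiesFirst u v = ∀ j → v ↾ j ≡ [] → u ↾ j ≡ []

-- For σ ∈ 𝔖ₙ the thresholds n ∸ k of the definition are exactly those ≤ n,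
-- and thresholds above n leave σ unchanged.
simsun⇔simsun↾ : ∀ {n σ} → All (_≤ n) σ → Simsun n σ ⇔ Simsun↾ σ
simsun⇔simsun↾ {n} {σ} σ≤n = mk⇔ fromSimsun (λ h k → h (n ∸ k))
  where
  fromSimsun : Simsun n σ → Simsun↾ σ
  fromSimsun h j with j ≤? n
  ... | yes j≤n = subst (λ i → NoDoubleDescent (σ ↾ i)) (m∸[m∸n]≡n j≤n) (h (n ∸ j))
  ... | no j≰n = subst NoDoubleDescent σ↾n≡σ↾j (h 0)
    where
    σ↾n≡σ↾j : σ ↾ n ≡ σ ↾ j
    σ↾n≡σ↾j = trans (filter-all (_≤? n) σ≤n)
                    (sym (filter-all (_≤? j) (All.map (λ x≤n → ≤-trans x≤n (<⇒≤ (≰⇒> j≰n))) σ≤n)))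

simsun↾-split : ∀ {m} u v → All (m <_) u → All (m <_) v →
  Simsun↾ (u ++ m ∷ v) ⇔ (Simsun↾ u × Simsun↾ v × NoEndDescent↾ u)
simsun↾-split {m} u v m<u m<v =
  mk⇔ (λ h → (λ j → proj₁ (to (at j) (h j))) , (λ j → proj₁ (proj₂ (to (at j) (h j))))
             , (λ j → proj₂ (proj₂ (to (at j) (h j)))))
      (λ (su , sv , nu) j → from (at j) (su j , sv j , nu j))
  where
  at : ∀ j → NoDoubleDescent ((u ++ m ∷ v) ↾ j) ⇔
             (NoDoubleDescent (u ↾ j) × NoDoubleDescent (v ↾ j) × ¬ EndsInDescent (u ↾ j))
  at j with m ≤? j
  ... | yes m≤j rewrite ↾-split u v m≤j =
    noDoubleDescent-split (u ↾ j) (v ↾ j) (filter⁺ (_≤? j) m<u) (filter⁺ (_≤? j) m<v)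
  ... | no m≰j
    rewrite ↾-below-min u (≰⇒> m≰j) (All.map <⇒≤ m<u) | ↾-below-min v (≰⇒> m≰j) (All.map <⇒≤ m<v)
          | ↾-below-min (u ++ m ∷ v) (≰⇒> m≰j) (min-lowerBound u v m<u m<v) =
    mk⇔ (λ _ → tt , tt , λ ()) (λ _ → tt)

noEndDescent↾-split : ∀ {m} u v → All (m <_) u → All (m <_) v →
  NoEndDescent↾ (u ++ m ∷ v) ⇔ (NoEndDescent↾ v × EmptiesFirst u v)
noEndDescent↾-split {m} u v m<u m<v =
  mk⇔ (λ h → (λ j → proj₁ (to (at j) (h j))) , (λ j → proj₂ (to (at j) (h j))))
      (λ (nv , e) j → from (at j) (nv j , e j))
  where
  at : ∀ j → (¬ EndsInDescent ((u ++ m ∷ v) ↾ j)) ⇔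
             (¬ EndsInDescent (v ↾ j) × (v ↾ j ≡ [] → u ↾ j ≡ []))
  at j with m ≤? j
  ... | yes m≤j rewrite ↾-split u v m≤j =
    noEndDescent-split (u ↾ j) (v ↾ j) (filter⁺ (_≤? j) m<u) (filter⁺ (_≤? j) m<v)
  ... | no m≰j
    rewrite ↾-below-min u (≰⇒> m≰j) (All.map <⇒≤ m<u) | ↾-below-min v (≰⇒> m≰j) (All.map <⇒≤ m<v)
          | ↾-below-min (u ++ m ∷ v) (≰⇒> m≰j) (min-lowerBound u v m<u m<v) =
    mk⇔ (λ _ → (λ ()) , λ _ → refl) (λ _ ())

-- Min-trees as a relation: MinTree w t says that t = T(w) for a word w with
-- distinct letters (splitting at the minimum, recursively).

data MinTree : List ℕ → Tree → Set where
  leaf : MinTree [] leaf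
  node : ∀ {u v L R m} → MinTree u L → MinTree v R → All (m <_) u → All (m <_) v →
         Disjoint u v → MinTree (u ++ m ∷ v) (node L m R)

root-minimal : ∀ {w L b R} → MinTree w (node L b R) → b ∈ w × All (b ≤_) w
root-minimal (node {u} {v} _ _ b<u b<v _) = ∈-++⁺ʳ u (here refl) , min-lowerBound u v b<u b<v

RootsDecrease : Tree → Tree → Set
RootsDecrease leaf _ = ⊤
RootsDecrease (node _ _ _) leaf = ⊥
RootsDecrease (node _ b _) (node _ c _) = b > c

-- A threshold empties a word iff it lies below its minimum, i.e. the root of
-- its min-tree; so "v empties first" compares the two roots.
emptiesFirst⇔rootsDecrease : ∀ {u v L R} → MinTree u L → MinTree v R → Disjoint u v →
  EmptiesFirst u v ⇔ RootsDecrease L R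
emptiesFirst⇔rootsDecrease du dv u#v = mk⇔ (forward du dv u#v) (backward du dv)
  where
  forward : ∀ {u v L R} → MinTree u L → MinTree v R → Disjoint u v →
            EmptiesFirst u v → RootsDecrease L R
  forward leaf _ _ _ = tt
  forward du@(node _ _ _ _ _) leaf _ e =
    ↾-nonempty (proj₁ (root-minimal du)) ≤-refl (e _ refl)
  forward {v = v} du@(node {m = b} _ _ _ _ _) dv@(node {m = c} _ _ _ _ _) u#v e with c <? b
  ... | yes c<b = c<b
  ... | no c≮b = ⊥-elim (↾-nonempty b∈u ≤-refl (e b (↾-below-min v b<c c≤v)))
    where
    b∈u = proj₁ (root-minimal du)
    c≤v = proj₂ (root-minimal dv)
    b<c : b < c
    b<c = ≤∧≢⇒< (≮⇒≥ c≮b) (λ b≡c → u#v (b∈u , subst (_∈ v) (sym b≡c) (proj₁ (root-minimal dv))))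

  backward : ∀ {u v L R} → MinTree u L → MinTree v R → RootsDecrease L R → EmptiesFirst u v
  backward leaf _ _ _ _ = refl
  backward (node _ _ _ _ _) leaf ()
  backward {u} du@(node _ _ _ _ _) dv@(node {m = c} _ _ _ _ _) c<b j v↾j≡[] with c ≤? j
  ... | yes c≤j = ⊥-elim (↾-nonempty (proj₁ (root-minimal dv)) c≤j v↾j≡[])
  ... | no c≰j = ↾-below-min u (<-trans (≰⇒> c≰j) c<b) (proj₂ (root-minimal du))

TreeNoEndDescent : Tree → Set
TreeNoEndDescent leaf = ⊤
TreeNoEndDescent (node L m R) = TreeNoEndDescent R × RootsDecrease L R

TreeSimsun : Tree → Set
TreeSimsun leaf = ⊤
TreeSimsun (node L m R) = TreeSimsun L × TreeSimsun R × TreeNoEndDescent L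

noEndDescent⇔tree : ∀ {w t} → MinTree w t → NoEndDescent↾ w ⇔ TreeNoEndDescent t
noEndDescent⇔tree leaf = mk⇔ (λ _ → tt) (λ _ _ ())
noEndDescent⇔tree (node {u} {v} du dv m<u m<v u#v) =
  ⇔-trans (noEndDescent↾-split u v m<u m<v)
          (noEndDescent⇔tree dv ×-⇔ emptiesFirst⇔rootsDecrease du dv u#v)

simsun⇔tree : ∀ {w t} → MinTree w t → Simsun↾ w ⇔ TreeSimsun t
simsun⇔tree leaf = mk⇔ (λ _ → tt) (λ _ _ → tt)
simsun⇔tree (node {u} {v} du dv m<u m<v _) =
  ⇔-trans (simsun↾-split u v m<u m<v)
          (simsun⇔tree du ×-⇔ (simsun⇔tree dv ×-⇔ noEndDescent⇔tree du))

-- In a subtree hanging off the rightmost path, TreeSimsun together with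
-- TreeNoEndDescent is exactly the local condition at every node.
offPath-local : ∀ t → TreeSimsun t → TreeNoEndDescent t → NoLoneLeft t × AllNodesLeftGtRight t
offPath-local leaf _ _ = tt , tt
offPath-local (node leaf a R) (_ , sR , _) (nR , _) =
  let (lR , gR) = offPath-local R sR nR in (tt , lR) , (tt , gR)
offPath-local (node (node _ _ _) a leaf) _ (_ , ())
offPath-local (node L@(node _ _ _) a R@(node _ _ _)) (sL , sR , nL) (nR , b>c) =
  let (lL , gL) = offPath-local L sL nL ; (lR , gR) = offPath-local R sR nR
  in (lL , lR) , (b>c , gL , gR)

local-offPath : ∀ t → NoLoneLeft t → AllNodesLeftGtRight t → TreeSimsun t × TreeNoEndDescent t
local-offPath leaf _ _ = tt , tt
local-offPath (node leaf a R) (_ , lR) (_ , gR) =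
  let (sR , nR) = local-offPath R lR gR in (tt , sR , tt) , (nR , tt)
local-offPath (node (node _ _ _) a leaf) () _
local-offPath (node L@(node _ _ _) a R@(node _ _ _)) (lL , lR) (b>c , gL , gR) =
  let (sL , nL) = local-offPath L lL gL ; (sR , nR) = local-offPath R lR gR
  in (sL , sR , nL) , (nR , b>c)

RightmostNoLeftChild : Tree → Set
RightmostNoLeftChild leaf = ⊤
RightmostNoLeftChild (node L a leaf) = L ≡ leaf
RightmostNoLeftChild (node L a R@(node _ _ _)) = RightmostNoLeftChild R

-- Along the rightmost path TreeSimsun imposes no local condition, and the
-- left subtrees of path nodes are handled by offPath-local.
treeSimsun⇔conditions : ∀ t → RightmostNoLeftChild t →
  TreeSimsun t ⇔ (NoLoneLeft t × OffRightPathCond t)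
treeSimsun⇔conditions t r = mk⇔ (forward t r) (backward t r)
  where
  forward : ∀ t → RightmostNoLeftChild t → TreeSimsun t → NoLoneLeft t × OffRightPathCond t
  forward leaf _ _ = tt , tt
  forward (node .leaf a leaf) refl _ = (tt , tt) , (tt , tt)
  forward (node leaf a R@(node _ _ _)) r (_ , sR , _) =
    let (lR , oR) = forward R r sR in (tt , lR) , (tt , oR)
  forward (node L@(node _ _ _) a R@(node _ _ _)) r (sL , sR , nL) =
    let (lL , gL) = offPath-local L sL nL ; (lR , oR) = forward R r sR
    in (lL , lR) , (gL , oR)

  backward : ∀ t → RightmostNoLeftChild t → NoLoneLeft t × OffRightPathCond t → TreeSimsun t
  backward leaf _ _ = tt
  backward (node .leaf a leaf) refl _ = tt , tt , tt
  backward (node leaf a R@(node _ _ _)) r ((_ , lR) , (_ , oR)) = tt , backward R r (lR , oR) , tt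
  backward (node L@(node _ _ _) a R@(node _ _ _)) r ((lL , lR) , (gL , oR)) =
    let (sL , nL) = local-offPath L lL gL in sL , backward R r (lR , oR) , nL

last-++ : ∀ {x : ℕ} {r} u → last (u ++ x ∷ r) ≡ last (x ∷ r)
last-++ [] = refl
last-++ (a ∷ []) = refl
last-++ (a ∷ b ∷ u) = last-++ (b ∷ u)

-- In-order reading ends at the rightmost node.
rightmostLabel≡last : ∀ {w t} → MinTree w t → rightmostLabel t ≡ last w
rightmostLabel≡last leaf = refl
rightmostLabel≡last (node {u} _ leaf _ _ _) = sym (last-++ u)
rightmostLabel≡last (node {u} {m = m} _ dv@(node {p} {q} {L} {R} {c} _ _ _ _ _) _ _ _) = begin
  rightmostLabel (node L c R) ≡⟨ rightmostLabel≡last dv ⟩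
  last (p ++ c ∷ q)          ≡⟨ last-++ p ⟩
  last (c ∷ q)               ≡⟨ sym (last-++ (m ∷ p)) ⟩
  last (m ∷ p ++ c ∷ q)      ≡⟨ sym (last-++ u) ⟩
  last (u ++ m ∷ p ++ c ∷ q) ∎
  where open ≡-Reasoning

-- If the rightmost label is the largest letter n, a left child of the
-- rightmost node would carry a label > n.
rightmostMax⇒noLeftChild : ∀ {n w t} → MinTree w t → All (_≤ n) w →
  rightmostLabel t ≡ just n → RightmostNoLeftChild t
rightmostMax⇒noLeftChild leaf _ _ = tt
rightmostMax⇒noLeftChild (node leaf leaf _ _ _) _ _ = refl
rightmostMax⇒noLeftChild (node {u} du@(node {m = b} _ _ _ _ _) leaf a<u _ _) w≤n a≡n =
  ⊥-elim (<⇒≱ (subst (_< b) (just-injective a≡n) (All.lookup a<u b∈u)) (All.lookup (++⁻ˡ u w≤n) b∈u))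
  where b∈u = proj₁ (root-minimal du)
rightmostMax⇒noLeftChild (node {u} _ dv@(node _ _ _ _ _) _ _ _) w≤n r≡n =
  rightmostMax⇒noLeftChild dv (All.tail (++⁻ʳ u w≤n)) r≡n

minOf-∈ : ∀ a xs → minOf a xs ∈ (a ∷ xs)
minOf-∈ a [] = here refl
minOf-∈ a (x ∷ xs) with x <? a
... | yes _ = there (minOf-∈ x xs)
... | no _ with minOf-∈ a xs
...   | here eq = here eq
...   | there p = there (there p)

minOf-≤ : ∀ a xs → All (minOf a xs ≤_) (a ∷ xs)
minOf-≤ a [] = ≤-refl ∷ []
minOf-≤ a (x ∷ xs) with x <? a
... | yes x<a with minOf-≤ x xs
...   | m≤x ∷ m≤xs = ≤-trans m≤x (<⇒≤ x<a) ∷ m≤x ∷ m≤xs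
minOf-≤ a (x ∷ xs) | no x≮a with minOf-≤ a xs
...   | m≤a ∷ m≤xs = m≤a ∷ ≤-trans m≤a (≮⇒≥ x≮a) ∷ m≤xs

splitAt'-correct : ∀ m w → m ∈ w → w ≡ proj₁ (splitAt' m w) ++ m ∷ proj₂ (splitAt' m w)
splitAt'-correct m (x ∷ xs) m∈w with x ≟ m
... | yes refl = refl
... | no x≢m with splitAt' m xs | splitAt'-correct m xs (m∈xs m∈w)
  where
  m∈xs : m ∈ x ∷ xs → m ∈ xs
  m∈xs (here m≡x) = ⊥-elim (x≢m (sym m≡x))
  m∈xs (there m∈xs) = m∈xs
...   | (l , r) | xs≡lmr = cong (x ∷_) xs≡lmr

unique-++⁻ : ∀ (u : List ℕ) {v} → Unique (u ++ v) → Unique u × Unique v × Disjoint u v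
unique-++⁻ [] U = [] , U , λ ()
unique-++⁻ (x ∷ u) (x∉uv ∷ U) =
  let (Uu , Uv , u#v) = unique-++⁻ u U
  in (++⁻ˡ u x∉uv ∷ Uu) , Uv , λ where
       (here refl , y∈v) → All.lookup x∉uv (∈-++⁺ʳ u y∈v) refl
       (there y∈u , y∈v) → u#v (y∈u , y∈v)

≤-∉⇒< : ∀ {m w} → All (m ≤_) w → m ∉ w → All (m <_) w
≤-∉⇒< {w = w} m≤w m∉w =
  All.tabulate (λ {x} x∈w → ≤∧≢⇒< (All.lookup m≤w x∈w) (λ m≡x → m∉w (subst (_∈ w) (sym m≡x) x∈w)))

length-split : ∀ {f m : ℕ} (l r : List ℕ) → length (l ++ m ∷ r) ≤ suc f → length l ≤ f × length r ≤ f
length-split {f} l r le = m+n≤o⇒m≤o (length l) le′ , m+n≤o⇒n≤o (length l) le′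
  where
  le′ : length l + length r ≤ f
  le′ = s≤s⁻¹ (subst (_≤ suc f) (trans (length-++ l) (+-suc (length l) (length r))) le)

minTreeF-correct : ∀ f w → length w ≤ f → Unique w → MinTree w (minTreeF f w)
minTreeF-correct zero [] _ _ = leaf
minTreeF-correct (suc f) [] _ _ = leaf
minTreeF-correct (suc f) (a ∷ xs) le U with minOf a xs | minOf-∈ a xs | minOf-≤ a xs
... | m | m∈w | m≤w with splitAt' m (a ∷ xs) | splitAt'-correct m (a ∷ xs) m∈w
... | (l , r) | w≡lmr =
  subst (λ w → MinTree w (node (minTreeF f l) m (minTreeF f r))) (sym w≡lmr)
    (node (minTreeF-correct f l l≤f Ul) (minTreeF-correct f r r≤f Ur)
          (≤-∉⇒< (++⁻ˡ l m≤lmr) (λ m∈l → l#mr (m∈l , here refl)))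
          (≤-∉⇒< (All.tail (++⁻ʳ l m≤lmr)) m∉r)
          (λ (x∈l , x∈r) → l#mr (x∈l , there x∈r)))
  where
  m≤lmr : All (m ≤_) (l ++ m ∷ r)
  m≤lmr = subst (All (m ≤_)) w≡lmr m≤w
  Ulmr : Unique (l ++ m ∷ r)
  Ulmr = subst Unique w≡lmr U
  Ul : Unique l
  Ul = proj₁ (unique-++⁻ l Ulmr)
  l#mr : Disjoint l (m ∷ r)
  l#mr = proj₂ (proj₂ (unique-++⁻ l Ulmr))
  Umr : Unique (m ∷ r)
  Umr = proj₁ (proj₂ (unique-++⁻ l Ulmr))
  Ur : Unique r
  Ur = proj₁ (proj₂ (unique-++⁻ (m ∷ []) Umr))
  m∉r : m ∉ r
  m∉r m∈r = proj₂ (proj₂ (unique-++⁻ (m ∷ []) Umr)) (here refl , m∈r)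
  l≤f×r≤f : length l ≤ f × length r ≤ f
  l≤f×r≤f = length-split {m = m} l r (subst (λ w → length w ≤ suc f) w≡lmr le)
  l≤f = proj₁ l≤f×r≤f
  r≤f = proj₂ l≤f×r≤f

perm-unique : ∀ {n σ} → IsPerm n σ → Unique σ
perm-unique {n} σ↭ =
  Unique-resp-↭ (↭⇒↭ₛ (↭-sym σ↭)) (applyUpTo⁺₁ suc n (λ i<j _ → <⇒≢ i<j ∘ suc-injective))

perm-bounded : ∀ {n σ} → IsPerm n σ → All (_≤ n) σ
perm-bounded σ↭ = All.tabulate λ x∈σ → bound (∈-applyUpTo⁻ suc (∈-resp-↭ σ↭ x∈σ))
  where
  bound : ∀ {x n} → ∃ (λ i → i < n × x ≡ suc i) → x ≤ n
  bound (i , i<n , refl) = i<n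

proposition7p5 : (n : ℕ) (σ : List ℕ) → IsPerm n σ →
    (InSS n σ ⇔ (rightmostLabel (T σ) ≡ just n × NoLoneLeft (T σ) × OffRightPathCond (T σ)))
proposition7p5 n σ σ∈𝔖n = mk⇔
  (λ (simsun , last≡n) →
     let rl≡n = trans rl≡last last≡n
     in rl≡n , to (conditions rl≡n) (to (simsun⇔tree D) (to (simsun⇔simsun↾ σ≤n) simsun)))
  (λ (rl≡n , conds) →
     from (simsun⇔simsun↾ σ≤n) (from (simsun⇔tree D) (from (conditions rl≡n) conds)) ,
     trans (sym rl≡last) rl≡n)
  where
  σ≤n = perm-bounded σ∈𝔖n
  D : MinTree σ (T σ)
  D = minTreeF-correct (length σ) σ ≤-refl (perm-unique σ∈𝔖n)
  rl≡last = rightmostLabel≡last D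
  conditions : rightmostLabel (T σ) ≡ just n →
               TreeSimsun (T σ) ⇔ (NoLoneLeft (T σ) × OffRightPathCond (T σ))
  conditions rl≡n = treeSimsun⇔conditions (T σ) (rightmostMax⇒noLeftChild D σ≤n rl≡n)
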